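{- Let $k$ be a positive even integer. For $0 \leq p \leq k/2$, \[ \mathsf{e}_{(k-p,p)} = \sum_{0 \leq q \leq p} \binom{k-2q}{p-q} \mathsf{m}_{2_k^q}. \] For $0 \leq q \leq k/2-1$, \[ \mathsf{m}_{2_k^q} = (-1)^q \sum_{0 \leq r \leq q} (-1)^r \mathsf{e}_{(k-r,r)} \left( \binom{k-q-r}{k-2q} + \binom{k-q-r-1}{k-2q} \right), \] and \[ \mathsf{m}_{2_k^{k/2}} = \mathsf{e}_{(k/2,k/2)} + 2 (-1)^{k/2} \sum_{0 \leq r \leq k/2-1} (-1)^r \mathsf{e}_{(k-r,r)} = (-1)^{k/2} \sum_{i+j=k} (-1)^i \mathsf{e}_i \mathsf{e}_j. \]
   Context: These are identities in the ring of symmetric functions. $\mathsf{e}_n$ is the $n$-th elementary symmetric function with $\mathsf{e}_0=1$, and $\mathsf{e}_{(a,b)}=\mathsf{e}_a\mathsf{e}_b$. $\mathsf{m}_\mu$ is the monomial symmetric function indexed by the partition $\mu$. For $0\le q\le k/2$, $2_k^q$ is the partition of $k$ with $q$ parts equal to $2$ and $k-2q$ parts equal to $1$. Binomial coefficients $\binom{n}{m}$ with $m>n\ge 0$ are $0$. -}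

module Defs where

open import Data.Nat using (ℕ; zero; suc)
open import Data.List using (List; []; _∷_)
open import Data.Bool using (Bool; true; false; if_then_else_)
open import Algebra.Bundles using (CommutativeRing)

-- Symmetric functions are represented by their evaluations at an arbitrary
-- finite list of variables x₁,…,x_N taking values in an arbitrary
-- commutative ring R.  (An integral identity holds in Λ iff it holds in
-- Λ_N for all N iff it holds for all such evaluations.)

allZero : List ℕ → Bool
allZero [] = true
allZero (zero ∷ μ) = allZero μ
allZero (suc _ ∷ _) = false

module Sym {c ℓ} (R : CommutativeRing c ℓ) where
  open CommutativeRing R hiding (zero)

  S : Set c
  S = Carrier
  infix 4 _≈R_
  infixl 6 _+R_
  infixl 7 _*R_
  _≈R_ : S → S → Set ℓ
  _≈R_ = _≈_
  _+R_ _*R_ : S → S → S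
  _+R_ = _+_
  _*R_ = _*_
  1R : S
  1R = 1#

  pow : Carrier → ℕ → Carrier
  pow x zero = 1#
  pow x (suc n) = x * pow x n

  sgn : ℕ → Carrier → Carrier
  sgn zero y = y
  sgn (suc n) y = - sgn n y

  infixr 8 _·_
  _·_ : ℕ → Carrier → Carrier
  zero · y = 0#
  suc n · y = y + n · y

  sumTo : ℕ → (ℕ → Carrier) → Carrier
  sumTo zero f = f 0
  sumTo (suc n) f = sumTo n f + f (suc n)

  e : ℕ → List Carrier → Carrier
  e zero xs = 1#
  e (suc n) [] = 0#
  e (suc n) (x ∷ xs) = e (suc n) xs + x * e n xs

  e₂ : ℕ → ℕ → List Carrier → Carrier
  e₂ a b xs = e a xs * e b xs

  -- Monomial symmetric function m_λ, with the partition λ given by its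
  -- multiplicity list μ = [μ₁, μ₂, …] (μᵢ = number of parts equal to i).
  -- m_λ(x₁,…,x_N) = Σ over distinct exponent vectors α that are
  -- rearrangements of λ (padded with zeros) of x^α.  Recursion on the
  -- first variable: it gets exponent 0, or exponent i for some part i of λ.
  -- choose x f i μ : sum over positions j ≥ i with a nonzero multiplicity of
  --   x^j * f (μ with that multiplicity decremented)
  choose : Carrier → (List ℕ → Carrier) → ℕ → List ℕ → Carrier
  choose x f i [] = 0#
  choose x f i (zero ∷ μ) = choose x (λ ν → f (zero ∷ ν)) (suc i) μ
  choose x f i (suc a ∷ μ) =
    pow x i * f (a ∷ μ) + choose x (λ ν → f (suc a ∷ ν)) (suc i) μ

  m : List ℕ → List Carrier → Carrier
  m μ [] = if allZero μ then 1# else 0#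
  m μ (x ∷ xs) = m μ xs + choose x (λ ν → m ν xs) 1 μ

-- the partition 2_k^q : q parts equal to 2 and k-2q parts equal to 1,
-- as a multiplicity list
open import Data.Nat using (_∸_; _*_)
two : ℕ → ℕ → List ℕ
two k q = (k ∸ 2 * q) ∷ q ∷ []

-- Both sides of each identity are evaluated at an explicit list of variables and compared by
-- induction on that list.  Adjoining a variable x sends e_a e_b to
--   e_a e_b + x (e_{a-1} e_b + e_a e_{b-1}) + x² e_{a-1} e_{b-1}
-- and m_{2^b 1^a} to m_{2^b 1^a} + x m_{2^b 1^{a-1}} + x² m_{2^{b-1} 1^a}, so it suffices that
-- both expansions commute with these two lowering operations.  In the coordinates d = k - 2p
-- (resp. k - 2q) and j = p - q (resp. q - r) this reduces to Pascal-type recurrences for the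
-- coefficients C(d+2j, j) and C(d+j, d) + C(d+j-1, d).  For d = 0 the x-coefficient of the
-- inversion is Σ_{i+j=2q} (-1)^i (e_{i-1} e_j + e_i e_{j-1}), whose two halves cancel after a
-- shift; folding Σ_{i+j=2h} (-1)^i e_i e_j about its middle term gives the closed form of m_{2^h}.

module Submission where

open import Defs
open import Data.Nat using (ℕ; zero; suc; _+_; _∸_; _*_; _≤_; _<_; _/_; z≤n; s≤s)
import Data.Nat.Properties as ℕ
open import Data.Nat.Combinatorics
  using (_C_; nCk+nC[k+1]≡[n+1]C[k+1]; nCk≡nC[n∸k]; nCn≡1; nC1≡n; k>n⇒nCk≡0)
open import Data.Nat.Divisibility using (_∣_; divides)
open import Data.Nat.DivMod using (m*n/n≡m)
open import Data.Nat.Tactic.RingSolver using (solve-∀)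
open import Data.List using (List; []; _∷_)
open import Data.Product using (_×_; _,_)
open import Algebra.Bundles using (CommutativeRing)
open import Relation.Binary.PropositionalEquality as ≡ using (_≡_)

+-2*-suc : ∀ d j → d + 2 * suc j ≡ suc (suc (d + 2 * j))
+-2*-suc = solve-∀

-- The coefficients of the two expansions, defined by the recurrences the inductions use.
-- mToE 0, the case of m_{2^h}, has no binomial form of the statement's shape.
eToM : ℕ → ℕ → ℕ
eToM d       zero    = 1
eToM zero    (suc j) = eToM 1 j + eToM 1 j
eToM (suc d) (suc j) = eToM d (suc j) + eToM (suc (suc d)) j

mToE : ℕ → ℕ → ℕ
mToE d       zero    = 1
mToE zero    (suc j) = 2
mToE (suc d) (suc j) = mToE d (suc j) + mToE (suc d) j

eToM≡C : ∀ d j → eToM d j ≡ (d + 2 * j) C j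
eToM≡C d zero = ≡.refl
eToM≡C zero (suc j) = begin
  eToM 1 j + eToM 1 j        ≡⟨ ≡.cong₂ _+_ (eToM≡C 1 j) (eToM≡C 1 j) ⟩
  N C j + N C j              ≡⟨ ≡.cong (N C j +_) symmetric ⟨
  N C j + N C suc j          ≡⟨ nCk+nC[k+1]≡[n+1]C[k+1] N j ⟩
  suc N C suc j              ≡⟨ ≡.cong (_C suc j) (+-2*-suc 0 j) ⟨
  (0 + 2 * suc j) C suc j    ∎
  where
  open ≡.≡-Reasoning
  N = 1 + 2 * j
  symmetric : N C suc j ≡ N C j
  symmetric = ≡.trans (nCk≡nC[n∸k] (s≤s (ℕ.m≤m+n j (j + 0))))
                      (≡.cong (N C_) (≡.trans (ℕ.m+n∸m≡n j (j + 0)) (ℕ.+-identityʳ j)))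
eToM≡C (suc d) (suc j) = begin
  eToM d (suc j) + eToM (2 + d) j     ≡⟨ ≡.cong₂ _+_ (eToM≡C d (suc j)) (eToM≡C (2 + d) j) ⟩
  (d + 2 * suc j) C suc j + N C j     ≡⟨ ≡.cong (λ M → M C suc j + N C j) (+-2*-suc d j) ⟩
  N C suc j + N C j                   ≡⟨ ℕ.+-comm (N C suc j) (N C j) ⟩
  N C j + N C suc j                   ≡⟨ nCk+nC[k+1]≡[n+1]C[k+1] N j ⟩
  suc N C suc j                       ≡⟨ ≡.cong (λ M → suc M C suc j) (+-2*-suc d j) ⟨
  (suc d + 2 * suc j) C suc j         ∎
  where
  open ≡.≡-Reasoning
  N = 2 + d + 2 * j

mToE≡C : ∀ d j → mToE (suc d) j ≡ (suc d + j) C suc d + (d + j) C suc d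
mToE≡C d zero = begin
  1                                        ≡⟨ ≡.cong₂ _+_ (nCn≡1 (suc d)) (k>n⇒nCk≡0 (ℕ.n<1+n d)) ⟨
  suc d C suc d + d C suc d                ≡⟨ ≡.cong₂ (λ a b → a C suc d + b C suc d)
                                                      (ℕ.+-identityʳ (suc d)) (ℕ.+-identityʳ d) ⟨
  (suc d + 0) C suc d + (d + 0) C suc d    ∎
  where open ≡.≡-Reasoning
mToE≡C zero (suc j) = begin
  2 + mToE 1 j                        ≡⟨ ≡.cong (2 +_) (mToE≡C 0 j) ⟩
  2 + ((1 + j) C 1 + j C 1)           ≡⟨ ≡.cong₂ (λ a b → 2 + (a + b)) (nC1≡n (1 + j)) (nC1≡n j) ⟩
  2 + ((1 + j) + j)                   ≡⟨ rearrange j ⟩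
  (2 + j) + (1 + j)                   ≡⟨ ≡.cong₂ _+_ (nC1≡n (2 + j)) (nC1≡n (1 + j)) ⟨
  (2 + j) C 1 + (1 + j) C 1           ∎
  where
  open ≡.≡-Reasoning
  rearrange : ∀ j → 2 + ((1 + j) + j) ≡ (2 + j) + (1 + j)
  rearrange = solve-∀
mToE≡C (suc d) (suc j) = begin
  mToE (suc d) (suc j) + mToE (2 + d) j
    ≡⟨ ≡.cong₂ _+_ (mToE≡C d (suc j)) (mToE≡C (suc d) j) ⟩
  (A C suc d + B C suc d) + ((2 + d + j) C (2 + d) + (suc d + j) C (2 + d))
    ≡⟨ ≡.cong₂ (λ a b → (A C suc d + B C suc d) + (a C (2 + d) + b C (2 + d)))
               (≡.cong suc (ℕ.+-suc d j)) (ℕ.+-suc d j) ⟨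
  (A C suc d + B C suc d) + (A C (2 + d) + B C (2 + d))
    ≡⟨ interchange (A C suc d) (B C suc d) (A C (2 + d)) (B C (2 + d)) ⟩
  (A C suc d + A C (2 + d)) + (B C suc d + B C (2 + d))
    ≡⟨ ≡.cong₂ _+_ (nCk+nC[k+1]≡[n+1]C[k+1] A (suc d)) (nCk+nC[k+1]≡[n+1]C[k+1] B (suc d)) ⟩
  suc A C (2 + d) + suc B C (2 + d)   ∎
  where
  open ≡.≡-Reasoning
  A = suc d + suc j
  B = d + suc j
  interchange : ∀ a b c e → (a + b) + (c + e) ≡ (a + c) + (b + e)
  interchange = solve-∀

module TwoRow {c ℓ} (R : CommutativeRing c ℓ) where
  open CommutativeRing R hiding (zero; _+_; _*_)
  open Sym R
  open import Algebra.Properties.Ring ring using (-‿+-comm; -0#≈0#; -‿distribˡ-*; -‿involutive)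
  open import Algebra.Properties.CommutativeSemigroup +-commutativeSemigroup
    using (interchange; xy∙z≈xz∙y; x∙yz≈xz∙y)
  open import Relation.Binary.Reasoning.Setoid setoid
  open import Algebra.Solver.Ring.NaturalCoefficients.Default commutativeSemiring
    using (solve; _:=_; _:+_; _:*_; con)

  sgn-cong : ∀ n {a b} → a ≈ b → sgn n a ≈ sgn n b
  sgn-cong zero    a≈b = a≈b
  sgn-cong (suc n) a≈b = -‿cong (sgn-cong n a≈b)

  sgn-+ : ∀ n a b → sgn n (a +R b) ≈ sgn n a +R sgn n b
  sgn-+ zero    a b = refl
  sgn-+ (suc n) a b = trans (-‿cong (sgn-+ n a b)) (sym (-‿+-comm _ _))

  sgn-*ˡ : ∀ n a b → sgn n a *R b ≈ sgn n (a *R b)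
  sgn-*ˡ zero    a b = refl
  sgn-*ˡ (suc n) a b = trans (sym (-‿distribˡ-* _ _)) (-‿cong (sgn-*ˡ n a b))

  sgn-*ʳ : ∀ n a b → a *R sgn n b ≈ sgn n (a *R b)
  sgn-*ʳ n a b = trans (*-comm _ _) (trans (sgn-*ˡ n b a) (sgn-cong n (*-comm _ _)))

  sgn-0# : ∀ n → sgn n 0# ≈ 0#
  sgn-0# zero    = refl
  sgn-0# (suc n) = trans (-‿cong (sgn-0# n)) -0#≈0#

  sgn-homo-+ : ∀ m n a → sgn (m + n) a ≡ sgn m (sgn n a)
  sgn-homo-+ zero    n a = ≡.refl
  sgn-homo-+ (suc m) n a = ≡.cong -_ (sgn-homo-+ m n a)

  sgn-neg : ∀ n a → sgn n (- a) ≡ - sgn n a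
  sgn-neg zero    a = ≡.refl
  sgn-neg (suc n) a = ≡.cong -_ (sgn-neg n a)

  sgn-involutive : ∀ n a → sgn n (sgn n a) ≈ a
  sgn-involutive zero    a = refl
  sgn-involutive (suc n) a = begin
    - sgn n (- sgn n a)     ≡⟨ ≡.cong -_ (sgn-neg n (sgn n a)) ⟩
    - - sgn n (sgn n a)     ≈⟨ -‿involutive _ ⟩
    sgn n (sgn n a)         ≈⟨ sgn-involutive n a ⟩
    a                       ∎

  sgn-2* : ∀ n a → sgn (2 * n) a ≈ a
  sgn-2* n a = begin
    sgn (n + (n + 0)) a     ≡⟨ ≡.cong (λ k → sgn (n + k) a) (ℕ.+-identityʳ n) ⟩
    sgn (n + n) a           ≡⟨ sgn-homo-+ n n a ⟩
    sgn n (sgn n a)         ≈⟨ sgn-involutive n a ⟩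
    a                       ∎

  sgn-antidiagonal : ∀ r t {q} → r + t ≡ q → ∀ a → sgn q (sgn r a) ≈ sgn t a
  sgn-antidiagonal r t ≡.refl a = begin
    sgn (r + t) (sgn r a)   ≡⟨ ≡.cong (λ k → sgn k (sgn r a)) (ℕ.+-comm r t) ⟩
    sgn (t + r) (sgn r a)   ≡⟨ sgn-homo-+ t r _ ⟩
    sgn t (sgn r (sgn r a)) ≈⟨ sgn-cong t (sgn-involutive r a) ⟩
    sgn t a                 ∎

  ·-homo-+ : ∀ m n a → (m + n) · a ≈ m · a +R n · a
  ·-homo-+ zero    n a = sym (+-identityˡ _)
  ·-homo-+ (suc m) n a = trans (+-congˡ (·-homo-+ m n a)) (sym (+-assoc _ _ _))

  ·≈·1* : ∀ n a → n · a ≈ (n · 1R) *R a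
  ·≈·1* zero    a = sym (zeroˡ a)
  ·≈·1* (suc n) a = trans (+-cong (sym (*-identityˡ a)) (·≈·1* n a)) (sym (distribʳ a 1# (n · 1#)))

  prev : (ℕ → S) → ℕ → S
  prev f zero    = 0#
  prev f (suc n) = f n

  prev-cong : ∀ {f g : ℕ → S} → (∀ n → f n ≈ g n) → ∀ n → prev f n ≈ prev g n
  prev-cong f≈g zero    = refl
  prev-cong f≈g (suc n) = f≈g n

  sumTo-shift : ∀ n (f : ℕ → S) → sumTo (suc n) f ≈ f 0 +R sumTo n (λ i → f (suc i))
  sumTo-shift zero    f = refl
  sumTo-shift (suc n) f = trans (+-congʳ (sumTo-shift n f)) (+-assoc _ _ _)

  sumTo-cong : ∀ n {f g : ℕ → S} → (∀ i → i ≤ n → f i ≈ g i) → sumTo n f ≈ sumTo n g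
  sumTo-cong zero    f≈g = f≈g 0 z≤n
  sumTo-cong (suc n) f≈g =
    +-cong (sumTo-cong n (λ i i≤n → f≈g i (ℕ.m≤n⇒m≤1+n i≤n))) (f≈g (suc n) ℕ.≤-refl)

  sumTo-sgn : ∀ n k (f : ℕ → S) → sumTo n (λ i → sgn k (f i)) ≈ sgn k (sumTo n f)
  sumTo-sgn zero    k f = refl
  sumTo-sgn (suc n) k f = trans (+-congʳ (sumTo-sgn n k f)) (sym (sgn-+ k _ _))

  antidiagonal : ℕ → (ℕ → ℕ → S) → S
  antidiagonal zero    f = f 0 0
  antidiagonal (suc n) f = f 0 (suc n) +R antidiagonal n (λ i j → f (suc i) j)

  antidiagonal-cong : ∀ n {f g : ℕ → ℕ → S} → (∀ i j → i + j ≡ n → f i j ≈ g i j) →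
                      antidiagonal n f ≈ antidiagonal n g
  antidiagonal-cong zero    f≈g = f≈g 0 0 ≡.refl
  antidiagonal-cong (suc n) f≈g =
    +-cong (f≈g 0 (suc n) ≡.refl) (antidiagonal-cong n (λ i j eq → f≈g (suc i) j (≡.cong suc eq)))

  antidiagonal-+ : ∀ n (f g : ℕ → ℕ → S) →
                   antidiagonal n (λ i j → f i j +R g i j) ≈ antidiagonal n f +R antidiagonal n g
  antidiagonal-+ zero    f g = refl
  antidiagonal-+ (suc n) f g =
    trans (+-congˡ (antidiagonal-+ n _ _)) (interchange _ _ _ _)

  antidiagonal-*ˡ : ∀ n a (f : ℕ → ℕ → S) →
                    antidiagonal n (λ i j → a *R f i j) ≈ a *R antidiagonal n f
  antidiagonal-*ˡ zero    a f = refl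
  antidiagonal-*ˡ (suc n) a f = trans (+-congˡ (antidiagonal-*ˡ n a _)) (sym (distribˡ a _ _))

  antidiagonal-sgn : ∀ n k (f : ℕ → ℕ → S) →
                     antidiagonal n (λ i j → sgn k (f i j)) ≈ sgn k (antidiagonal n f)
  antidiagonal-sgn zero    k f = refl
  antidiagonal-sgn (suc n) k f = trans (+-congˡ (antidiagonal-sgn n k _)) (sym (sgn-+ k _ _))

  antidiagonal-0# : ∀ n → antidiagonal n (λ _ _ → 0#) ≈ 0#
  antidiagonal-0# zero    = refl
  antidiagonal-0# (suc n) = trans (+-congˡ (antidiagonal-0# n)) (+-identityˡ 0#)

  antidiagonal-last : ∀ n (f : ℕ → ℕ → S) →
                      antidiagonal (suc n) f ≈ antidiagonal n (λ i j → f i (suc j)) +R f (suc n) 0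
  antidiagonal-last zero    f = refl
  antidiagonal-last (suc n) f =
    trans (+-congˡ (antidiagonal-last n (λ i j → f (suc i) j))) (sym (+-assoc _ _ _))

  antidiagonal-sumTo : ∀ n (f : ℕ → ℕ → S) → antidiagonal n f ≈ sumTo n (λ i → f i (n ∸ i))
  antidiagonal-sumTo zero    f = refl
  antidiagonal-sumTo (suc n) f =
    trans (+-congˡ (antidiagonal-sumTo n (λ i j → f (suc i) j))) (sym (sumTo-shift n _))

  quadratic-cong : ∀ x {a a′ b b′ c c′} → a ≈ a′ → b ≈ b′ → c ≈ c′ →
                   a +R x *R b +R (x *R x) *R c ≈ a′ +R x *R b′ +R (x *R x) *R c′
  quadratic-cong x a≈ b≈ c≈ = +-cong (+-cong a≈ (*-congˡ b≈)) (*-congˡ c≈)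

  antidiagonal-quadratic : ∀ n x (k f g h : ℕ → ℕ → S) →
    antidiagonal n (λ i j → k i j *R (f i j +R x *R g i j +R (x *R x) *R h i j)) ≈
    antidiagonal n (λ i j → k i j *R f i j) +R x *R antidiagonal n (λ i j → k i j *R g i j)
      +R (x *R x) *R antidiagonal n (λ i j → k i j *R h i j)
  antidiagonal-quadratic n x k f g h = begin
    antidiagonal n (λ i j → k i j *R (f i j +R x *R g i j +R (x *R x) *R h i j))
      ≈⟨ antidiagonal-cong n (λ i j _ → expand x (k i j) (f i j) (g i j) (h i j)) ⟩
    antidiagonal n (λ i j → k i j *R f i j +R x *R (k i j *R g i j) +R (x *R x) *R (k i j *R h i j))
      ≈⟨ antidiagonal-+ n _ _ ⟩
    antidiagonal n (λ i j → k i j *R f i j +R x *R (k i j *R g i j))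
      +R antidiagonal n (λ i j → (x *R x) *R (k i j *R h i j))
      ≈⟨ +-cong (antidiagonal-+ n _ _) (antidiagonal-*ˡ n _ _) ⟩
    antidiagonal n (λ i j → k i j *R f i j) +R antidiagonal n (λ i j → x *R (k i j *R g i j))
      +R (x *R x) *R antidiagonal n (λ i j → k i j *R h i j)
      ≈⟨ +-congʳ (+-congˡ (antidiagonal-*ˡ n _ _)) ⟩
    _ ∎
    where
    expand : ∀ x k f g h → k *R (f +R x *R g +R (x *R x) *R h) ≈
                           k *R f +R x *R (k *R g) +R (x *R x) *R (k *R h)
    expand = solve 5 (λ x k f g h → k :* (f :+ x :* g :+ (x :* x) :* h) :=
                                    k :* f :+ x :* (k :* g) :+ (x :* x) :* (k :* h)) refl

  antidiagonal-pascal : ∀ {α β γ : ℕ → S} → γ 0 ≈ α 0 → (∀ j → γ (suc j) ≈ α (suc j) +R β j) →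
    ∀ n (T : ℕ → ℕ → S) →
    antidiagonal (suc n) (λ i j → γ j *R T i j) ≈
      antidiagonal (suc n) (λ i j → α j *R T i j) +R antidiagonal n (λ i j → β j *R T i (suc j))
  antidiagonal-pascal {α} {β} {γ} γ₀ γₛ n T = begin
    antidiagonal (suc n) (λ i j → γ j *R T i j)
      ≈⟨ antidiagonal-last n (λ i j → γ j *R T i j) ⟩
    antidiagonal n (λ i j → γ (suc j) *R T i (suc j)) +R γ 0 *R T (suc n) 0
      ≈⟨ +-cong (antidiagonal-cong n (λ i j _ → trans (*-congʳ (γₛ j)) (distribʳ _ _ _)))
                (*-congʳ γ₀) ⟩
    antidiagonal n (λ i j → α (suc j) *R T i (suc j) +R β j *R T i (suc j)) +R α 0 *R T (suc n) 0
      ≈⟨ +-congʳ (antidiagonal-+ n _ _) ⟩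
    (A +R B) +R α 0 *R T (suc n) 0
      ≈⟨ xy∙z≈xz∙y _ _ _ ⟩
    (A +R α 0 *R T (suc n) 0) +R B
      ≈⟨ +-congʳ (sym (antidiagonal-last n (λ i j → α j *R T i j))) ⟩
    antidiagonal (suc n) (λ i j → α j *R T i j) +R B ∎
    where
    A = antidiagonal n (λ i j → α (suc j) *R T i (suc j))
    B = antidiagonal n (λ i j → β j *R T i (suc j))

  pairUp : (ℕ → ℕ → S) → ℕ → ℕ → S
  pairUp G r zero    = G r r
  pairUp G r (suc t) = G r (r + 2 * suc t) +R G (r + 2 * suc t) r

  pairUp-suc : ∀ G r t → pairUp G (suc r) t ≡ pairUp (λ i j → G (suc i) (suc j)) r t
  pairUp-suc G r zero    = ≡.refl
  pairUp-suc G r (suc t) = ≡.refl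

  antidiagonal-fold : ∀ n (G : ℕ → ℕ → S) → antidiagonal (2 * n) G ≈ antidiagonal n (pairUp G)
  antidiagonal-fold zero    G = refl
  antidiagonal-fold (suc n) G = begin
    antidiagonal (2 * suc n) G
      ≡⟨ ≡.cong (λ k → antidiagonal k G) (+-2*-suc 0 n) ⟩
    G 0 N +R antidiagonal (suc (2 * n)) (λ i j → G (suc i) j)
      ≈⟨ +-congˡ (antidiagonal-last (2 * n) (λ i j → G (suc i) j)) ⟩
    G 0 N +R (antidiagonal (2 * n) G′ +R G N 0)
      ≈⟨ +-congˡ (+-congʳ (antidiagonal-fold n G′)) ⟩
    G 0 N +R (antidiagonal n (pairUp G′) +R G N 0)
      ≈⟨ x∙yz≈xz∙y _ _ _ ⟩
    (G 0 N +R G N 0) +R antidiagonal n (pairUp G′)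
      ≈⟨ +-cong (reflexive (≡.cong (λ k → G 0 k +R G k 0) (≡.sym (+-2*-suc 0 n))))
                (antidiagonal-cong n (λ r t _ → reflexive (≡.sym (pairUp-suc G r t)))) ⟩
    antidiagonal (suc n) (pairUp G) ∎
    where
    N = suc (suc (2 * n))
    G′ = λ i j → G (suc i) (suc j)

  infixl 7 _⊗_

  _⊗_ : (ℕ → S) → (ℕ → S) → ℕ → ℕ → S
  (f ⊗ g) i j = f i *R g j

  ∂⊗ : (ℕ → S) → ℕ → ℕ → S
  ∂⊗ f i j = prev f i *R f j +R f i *R prev f j

  ∂⊗-comm : ∀ f i j → ∂⊗ f i j ≈ ∂⊗ f j i
  ∂⊗-comm f i j = trans (+-comm _ _) (+-cong (*-comm _ _) (*-comm _ _))

  -- After shifting, the two halves are the same sum Σ_{i+j=n-1} (-1)^i f_i f_j with opposite signs.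
  antidiagonal-alternating-∂⊗ : ∀ f n → antidiagonal n (λ i j → sgn i (∂⊗ f i j)) ≈ 0#
  antidiagonal-alternating-∂⊗ f zero    = trans (+-cong (zeroˡ _) (zeroʳ _)) (+-identityʳ 0#)
  antidiagonal-alternating-∂⊗ f (suc n) = begin
    antidiagonal (suc n) (λ i j → sgn i (∂⊗ f i j))
      ≈⟨ antidiagonal-cong (suc n) (λ i j _ → sgn-+ i (prev f i *R f j) (f i *R prev f j)) ⟩
    antidiagonal (suc n) (λ i j → A i j +R B i j)
      ≈⟨ antidiagonal-+ (suc n) A B ⟩
    antidiagonal (suc n) A +R antidiagonal (suc n) B
      ≈⟨ +-cong (trans (+-congʳ (zeroˡ _)) (+-identityˡ _))
                (trans (antidiagonal-last n B)
                       (trans (+-congˡ (trans (sgn-cong (suc n) (zeroʳ _)) (sgn-0# (suc n))))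
                              (+-identityʳ _))) ⟩
    antidiagonal n (λ i j → - sgn i ((f ⊗ f) i j)) +R antidiagonal n (λ i j → sgn i ((f ⊗ f) i j))
      ≈⟨ antidiagonal-+ n _ _ ⟨
    antidiagonal n (λ i j → - sgn i ((f ⊗ f) i j) +R sgn i ((f ⊗ f) i j))
      ≈⟨ antidiagonal-cong n (λ i j _ → -‿inverseˡ _) ⟩
    antidiagonal n (λ _ _ → 0#)
      ≈⟨ antidiagonal-0# n ⟩
    0# ∎
    where
    A B : ℕ → ℕ → S
    A i j = sgn i (prev f i *R f j)
    B i j = sgn i (f i *R prev f j)

  -- The x-coefficient of e_{(p+d,p)}, written again in the family X d p = e_{(p+d,p)}
  -- (∂⊗-diagonal); for d = 0 the two lowered terms coincide.
  ∂e₂ : (ℕ → ℕ → S) → ℕ → ℕ → S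
  ∂e₂ X zero    zero    = 0#
  ∂e₂ X (suc d) zero    = X d 0
  ∂e₂ X zero    (suc p) = X 1 p +R X 1 p
  ∂e₂ X (suc d) (suc p) = X d (suc p) +R X (2 + d) p

  ∂e₂-cong : ∀ {X Y : ℕ → ℕ → S} → (∀ d p → X d p ≈ Y d p) →
             ∀ d p → ∂e₂ X d p ≈ ∂e₂ Y d p
  ∂e₂-cong X≈Y zero    zero    = refl
  ∂e₂-cong X≈Y (suc d) zero    = X≈Y d 0
  ∂e₂-cong X≈Y zero    (suc p) = +-cong (X≈Y 1 p) (X≈Y 1 p)
  ∂e₂-cong X≈Y (suc d) (suc p) = +-cong (X≈Y d (suc p)) (X≈Y (2 + d) p)

  ∂⊗-diagonal : ∀ f d p → ∂⊗ f (p + d) p ≈ ∂e₂ (λ d p → (f ⊗ f) (p + d) p) d p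
  ∂⊗-diagonal f zero zero = trans (+-cong (zeroˡ _) (zeroʳ _)) (+-identityʳ 0#)
  ∂⊗-diagonal f (suc d) zero = trans (+-congˡ (zeroʳ _)) (+-identityʳ _)
  ∂⊗-diagonal f zero (suc p) = +-cong
    (trans (*-comm _ _) (reflexive (≡.cong₂ (λ i j → f i *R f j) (ℕ.+-comm 1 p) (ℕ.+-identityʳ p))))
    (reflexive (≡.cong (λ i → f i *R f p) (≡.sym (ℕ.+-suc p 0))))
  ∂⊗-diagonal f (suc d) (suc p) = +-cong
    (reflexive (≡.cong (λ i → f i *R f (suc p)) (ℕ.+-suc p d)))
    (reflexive (≡.cong (λ i → f i *R f p) (≡.sym (ℕ.+-suc p (suc d)))))

  prev⊗prev-diagonal : ∀ f d p → (prev f ⊗ prev f) (p + d) p ≈ prev (λ p → (f ⊗ f) (p + d) p) p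
  prev⊗prev-diagonal f d zero    = zeroʳ _
  prev⊗prev-diagonal f d (suc p) = refl

  -- With Q a b = m_{2^b 1^a} this is the first expansion for k = 2p + d, with j = p - q.
  expansionSum : ℕ → ℕ → (ℕ → ℕ → S) → S
  expansionSum d p Q = antidiagonal p (λ q j → (eToM d j · 1R) *R Q (d + 2 * j) q)

  expansionSum-prev₁ : ∀ Q d p →
    expansionSum d p (λ a b → prev (λ a → Q a b) a) ≈ ∂e₂ (λ d p → expansionSum d p Q) d p
  expansionSum-prev₁ Q zero    zero    = zeroʳ _
  expansionSum-prev₁ Q (suc d) zero    = refl
  expansionSum-prev₁ Q zero    (suc p) = begin
    expansionSum 0 (suc p) (λ a b → prev (λ a → Q a b) a)
      ≈⟨ antidiagonal-last p (λ q j → (eToM 0 j · 1R) *R prev (λ a → Q a q) (2 * j)) ⟩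
    antidiagonal p (λ q j → (eToM 0 (suc j) · 1R) *R prev (λ a → Q a q) (2 * suc j))
      +R (1 · 1R) *R 0#
      ≈⟨ +-cong (antidiagonal-cong p (λ q j _ → split q j)) (zeroʳ _) ⟩
    antidiagonal p (λ q j → T q j +R T q j) +R 0#
      ≈⟨ +-identityʳ _ ⟩
    antidiagonal p (λ q j → T q j +R T q j)
      ≈⟨ antidiagonal-+ p T T ⟩
    expansionSum 1 p Q +R expansionSum 1 p Q ∎
    where
    T : ℕ → ℕ → S
    T q j = (eToM 1 j · 1R) *R Q (1 + 2 * j) q
    split : ∀ q j → (eToM 0 (suc j) · 1R) *R prev (λ a → Q a q) (2 * suc j) ≈ T q j +R T q j
    split q j = begin
      ((eToM 1 j + eToM 1 j) · 1R) *R prev (λ a → Q a q) (2 * suc j)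
        ≈⟨ *-cong (·-homo-+ (eToM 1 j) (eToM 1 j) 1R)
                  (reflexive (≡.cong (prev (λ a → Q a q)) (+-2*-suc 0 j))) ⟩
      (eToM 1 j · 1R +R eToM 1 j · 1R) *R Q (1 + 2 * j) q
        ≈⟨ distribʳ _ _ _ ⟩
      T q j +R T q j ∎
  expansionSum-prev₁ Q (suc d) (suc p) = begin
    antidiagonal (suc p) (λ q j → (eToM (suc d) j · 1R) *R Q (d + 2 * j) q)
      ≈⟨ antidiagonal-pascal refl (λ j → ·-homo-+ (eToM d (suc j)) (eToM (2 + d) j) 1R) p
                             (λ q j → Q (d + 2 * j) q) ⟩
    expansionSum d (suc p) Q
      +R antidiagonal p (λ q j → (eToM (2 + d) j · 1R) *R Q (d + 2 * suc j) q)
      ≈⟨ +-congˡ (antidiagonal-cong p (λ q j _ →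
           *-congˡ (reflexive (≡.cong (λ a → Q a q) (+-2*-suc d j))))) ⟩
    expansionSum d (suc p) Q +R expansionSum (2 + d) p Q ∎

  expansionSum-prev₂ : ∀ Q d p →
    expansionSum d p (λ a b → prev (Q a) b) ≈ prev (λ p → expansionSum d p Q) p
  expansionSum-prev₂ Q d zero    = zeroʳ _
  expansionSum-prev₂ Q d (suc p) = trans (+-congʳ (zeroʳ _)) (+-identityˡ _)

  -- With P a b = e_a e_b this is the second expansion for k = 2q + d, with t = q - r
  -- (so (-1)^t = (-1)^(q+r)).
  inversionSum : ℕ → ℕ → (ℕ → ℕ → S) → S
  inversionSum d q P = antidiagonal q (λ r t → sgn t (mToE d t · 1R) *R P (r + (d + 2 * t)) r)

  inversionSum-prev⊗prev : ∀ f d q →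
    inversionSum d q (prev f ⊗ prev f) ≈ prev (λ q → inversionSum d q (f ⊗ f)) q
  inversionSum-prev⊗prev f d zero    = trans (*-congˡ (zeroʳ _)) (zeroʳ _)
  inversionSum-prev⊗prev f d (suc q) =
    trans (+-congʳ (trans (*-congˡ (zeroʳ _)) (zeroʳ _))) (+-identityˡ _)

  -- Folding about the middle term, each off-diagonal pair contributes twice, matching mToE 0 (suc t) = 2.
  inversionSum-alternating : ∀ (P : ℕ → ℕ → S) → (∀ i j → P i j ≈ P j i) → ∀ q →
    inversionSum 0 q P ≈ sgn q (antidiagonal (2 * q) (λ i j → sgn i (P i j)))
  inversionSum-alternating P P-comm q = begin
    inversionSum 0 q P
      ≈⟨ antidiagonal-cong q term ⟩
    antidiagonal q (λ r t → sgn q (pairUp G r t))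
      ≈⟨ antidiagonal-sgn q q (pairUp G) ⟩
    sgn q (antidiagonal q (pairUp G))
      ≈⟨ sgn-cong q (sym (antidiagonal-fold q G)) ⟩
    sgn q (antidiagonal (2 * q) G) ∎
    where
    G : ℕ → ℕ → S
    G i j = sgn i (P i j)
    term : ∀ r t → r + t ≡ q → sgn t (mToE 0 t · 1R) *R P (r + 2 * t) r ≈ sgn q (pairUp G r t)
    term r zero r+0≡q = begin
      (1R +R 0#) *R P (r + 0) r      ≈⟨ *-congʳ (+-identityʳ 1R) ⟩
      1R *R P (r + 0) r              ≈⟨ *-identityˡ _ ⟩
      P (r + 0) r                    ≡⟨ ≡.cong (λ i → P i r) (ℕ.+-identityʳ r) ⟩
      P r r                          ≈⟨ sgn-antidiagonal r 0 r+0≡q (P r r) ⟨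
      sgn q (sgn r (P r r))          ∎
    term r (suc t) r+t≡q = begin
      sgn (suc t) (2 · 1R) *R P X r         ≈⟨ sgn-*ˡ (suc t) _ _ ⟩
      sgn (suc t) ((2 · 1R) *R P X r)       ≈⟨ sgn-cong (suc t) (double (P X r)) ⟩
      sgn (suc t) (P X r +R P X r)          ≈⟨ sgn-antidiagonal r (suc t) r+t≡q _ ⟨
      sgn q (sgn r (P X r +R P X r))        ≈⟨ sgn-cong q (sgn-+ r _ _) ⟩
      sgn q (sgn r (P X r) +R sgn r (P X r))
        ≈⟨ sgn-cong q (+-cong (sgn-cong r (P-comm X r)) (sym sgn-X)) ⟩
      sgn q (pairUp G r (suc t))            ∎
      where
      X = r + 2 * suc t
      double : ∀ a → (2 · 1R) *R a ≈ a +R a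
      double = solve 1 (λ a → (con 1 :+ (con 1 :+ con 0)) :* a := a :+ a) refl
      sgn-X : sgn X (P X r) ≈ sgn r (P X r)
      sgn-X = trans (reflexive (sgn-homo-+ r (2 * suc t) _)) (sgn-cong r (sgn-2* (suc t) _))

  sgn-mToE-pascal : ∀ d t → sgn (suc t) (mToE d (suc t) · 1R) ≈
    sgn (suc t) (mToE (suc d) (suc t) · 1R) +R sgn t (mToE (suc d) t · 1R)
  sgn-mToE-pascal d t = begin
    - sgn t (a · 1R)
      ≈⟨ +-identityʳ _ ⟨
    - sgn t (a · 1R) +R 0#
      ≈⟨ +-congˡ (-‿inverseˡ _) ⟨
    - sgn t (a · 1R) +R (- sgn t (b · 1R) +R sgn t (b · 1R))
      ≈⟨ +-assoc _ _ _ ⟨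
    (- sgn t (a · 1R) +R - sgn t (b · 1R)) +R sgn t (b · 1R)
      ≈⟨ +-congʳ (-‿+-comm _ _) ⟩
    - (sgn t (a · 1R) +R sgn t (b · 1R)) +R sgn t (b · 1R)
      ≈⟨ +-congʳ (-‿cong (trans (sym (sgn-+ t _ _)) (sgn-cong t (sym (·-homo-+ a b 1R))))) ⟩
    - sgn t ((a + b) · 1R) +R sgn t (b · 1R) ∎
    where
    a = mToE d (suc t)
    b = mToE (suc d) t

  inversionSum-∂⊗ : ∀ f d q →
    inversionSum d q (∂⊗ f) ≈ prev (λ d → inversionSum d q (f ⊗ f)) d
  inversionSum-∂⊗ f zero q = begin
    inversionSum 0 q (∂⊗ f)
      ≈⟨ inversionSum-alternating (∂⊗ f) (∂⊗-comm f) q ⟩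
    sgn q (antidiagonal (2 * q) (λ i j → sgn i (∂⊗ f i j)))
      ≈⟨ sgn-cong q (antidiagonal-alternating-∂⊗ f (2 * q)) ⟩
    sgn q 0#
      ≈⟨ sgn-0# q ⟩
    0# ∎
  inversionSum-∂⊗ f (suc d) zero = *-congˡ (trans (+-congˡ (zeroʳ _)) (+-identityʳ _))
  inversionSum-∂⊗ f (suc d) (suc q) = begin
    antidiagonal (suc q) (λ r t → κ t *R ∂⊗ f (r + (suc d + 2 * t)) r)
      ≈⟨ antidiagonal-cong (suc q) {g = λ r t → U r t +R V r t} (λ r t _ → distribˡ (κ t) _ _) ⟩
    antidiagonal (suc q) (λ r t → U r t +R V r t)
      ≈⟨ antidiagonal-+ (suc q) U V ⟩
    antidiagonal (suc q) U +R antidiagonal (suc q) V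
      ≈⟨ +-cong (antidiagonal-cong (suc q) {U} (λ r t _ → *-congˡ (lower r t)))
                (trans (+-congʳ (trans (*-congˡ (zeroʳ _)) (zeroʳ _)))
                       (trans (+-identityˡ _) (antidiagonal-cong q (λ r t _ → *-congˡ (shift r t))))) ⟩
    antidiagonal (suc q) (λ r t → κ t *R T r t) +R antidiagonal q (λ r t → κ t *R T r (suc t))
      ≈⟨ antidiagonal-pascal {α = κ} {β = κ} {γ = λ t → sgn t (mToE d t · 1R)} refl
                             (sgn-mToE-pascal d) q T ⟨
    inversionSum d (suc q) (f ⊗ f) ∎
    where
    κ : ℕ → S
    κ t = sgn t (mToE (suc d) t · 1R)
    U V : ℕ → ℕ → S
    U r t = κ t *R (prev f (r + (suc d + 2 * t)) *R f r)
    V r t = κ t *R (f (r + (suc d + 2 * t)) *R prev f r)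
    T : ℕ → ℕ → S
    T r t = f (r + (d + 2 * t)) *R f r
    lower : ∀ r t → prev f (r + (suc d + 2 * t)) *R f r ≈ T r t
    lower r t = reflexive (≡.cong (λ i → prev f i *R f r) (ℕ.+-suc r (d + 2 * t)))
    shift : ∀ r t → f (suc r + (suc d + 2 * t)) *R f r ≈ T r (suc t)
    shift r t = reflexive (≡.cong (λ i → f i *R f r)
      (≡.sym (≡.trans (≡.cong (r +_) (+-2*-suc d t)) (ℕ.+-suc r (suc (d + 2 * t))))))

  eSeq : List S → ℕ → S
  eSeq xs i = e i xs

  m₂ : ℕ → ℕ → List S → S
  m₂ a b = m (a ∷ b ∷ [])

  e-∷ : ∀ n x xs → e n (x ∷ xs) ≈ e n xs +R x *R prev (eSeq xs) n
  e-∷ zero    x xs = sym (trans (+-congˡ (zeroʳ x)) (+-identityʳ 1R))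
  e-∷ (suc n) x xs = refl

  e₂-∷ : ∀ a b x xs → e₂ a b (x ∷ xs) ≈
    e₂ a b xs +R x *R ∂⊗ (eSeq xs) a b +R (x *R x) *R (prev (eSeq xs) ⊗ prev (eSeq xs)) a b
  e₂-∷ a b x xs = trans (*-cong (e-∷ a x xs) (e-∷ b x xs)) (expand _ _ _ _ _)
    where
    expand : ∀ x u û v v̂ → (u +R x *R û) *R (v +R x *R v̂) ≈
                           u *R v +R x *R (û *R v +R u *R v̂) +R (x *R x) *R (û *R v̂)
    expand = solve 5 (λ x u û v v̂ → (u :+ x :* û) :* (v :+ x :* v̂) :=
                                    u :* v :+ x :* (û :* v :+ u :* v̂) :+ (x :* x) :* (û :* v̂)) refl

  m₂-∷ : ∀ a b x xs → m₂ a b (x ∷ xs) ≈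
    m₂ a b xs +R x *R prev (λ a → m₂ a b xs) a +R (x *R x) *R prev (λ b → m₂ a b xs) b
  m₂-∷ zero    zero    x xs = expand _ x
    where
    expand : ∀ u x → u +R 0# ≈ u +R x *R 0# +R (x *R x) *R 0#
    expand = solve 2 (λ u x → u :+ con 0 := u :+ x :* con 0 :+ (x :* x) :* con 0) refl
  m₂-∷ (suc a) zero    x xs = expand _ x _
    where
    expand : ∀ u x v → u +R ((x *R 1R) *R v +R 0#) ≈ u +R x *R v +R (x *R x) *R 0#
    expand = solve 3 (λ u x v → u :+ ((x :* con 1) :* v :+ con 0) :=
                                u :+ x :* v :+ (x :* x) :* con 0) refl
  m₂-∷ zero    (suc b) x xs = expand _ x _
    where
    expand : ∀ u x w → u +R ((x *R (x *R 1R)) *R w +R 0#) ≈ u +R x *R 0# +R (x *R x) *R w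
    expand = solve 3 (λ u x w → u :+ ((x :* (x :* con 1)) :* w :+ con 0) :=
                                u :+ x :* con 0 :+ (x :* x) :* w) refl
  m₂-∷ (suc a) (suc b) x xs = expand _ x _ _
    where
    expand : ∀ u x v w → u +R ((x *R 1R) *R v +R ((x *R (x *R 1R)) *R w +R 0#)) ≈
                         u +R x *R v +R (x *R x) *R w
    expand = solve 4 (λ u x v w → u :+ ((x :* con 1) :* v :+ ((x :* (x :* con 1)) :* w :+ con 0)) :=
                                  u :+ x :* v :+ (x :* x) :* w) refl

  m₂-[]-suc : ∀ a b → m₂ a (suc b) [] ≡ 0#
  m₂-[]-suc zero    b = ≡.refl
  m₂-[]-suc (suc a) b = ≡.refl

  e₂≈expansionSum-[] : ∀ d p → e₂ (p + d) p [] ≈ expansionSum d p (λ a b → m₂ a b [])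
  e₂≈expansionSum-[] zero    zero    = solve 0 (con 1 :* con 1 := (con 1 :+ con 0) :* con 1) refl
  e₂≈expansionSum-[] (suc d) zero    = trans (zeroˡ _) (sym (zeroʳ _))
  e₂≈expansionSum-[] d       (suc p) = trans (zeroʳ _) (sym (begin
    coeff (suc p) *R m₂ (d + 2 * suc p) 0 []
      +R antidiagonal p (λ q j → coeff j *R m₂ (d + 2 * j) (suc q) [])
      ≈⟨ +-cong (*-congˡ (reflexive (≡.cong (λ a → m₂ a 0 []) (+-2*-suc d p))))
                (antidiagonal-cong p (λ q j _ → *-congˡ (reflexive (m₂-[]-suc (d + 2 * j) q)))) ⟩
    coeff (suc p) *R 0# +R antidiagonal p (λ q j → coeff j *R 0#)
      ≈⟨ +-cong (zeroʳ _) (trans (antidiagonal-cong p (λ _ _ _ → zeroʳ _)) (antidiagonal-0# p)) ⟩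
    0# +R 0#
      ≈⟨ +-identityˡ 0# ⟩
    0# ∎))
    where
    coeff : ℕ → S
    coeff j = eToM d j · 1R

  e₂≈expansionSum : ∀ xs d p → e₂ (p + d) p xs ≈ expansionSum d p (λ a b → m₂ a b xs)
  e₂≈expansionSum []       d p = e₂≈expansionSum-[] d p
  e₂≈expansionSum (x ∷ xs) d p = begin
    e₂ (p + d) p (x ∷ xs)
      ≈⟨ e₂-∷ (p + d) p x xs ⟩
    e₂ (p + d) p xs +R x *R ∂⊗ E (p + d) p +R (x *R x) *R (prev E ⊗ prev E) (p + d) p
      ≈⟨ quadratic-cong x (IH d p) (trans (∂⊗-diagonal E d p) (∂e₂-cong IH d p))
                          (trans (prev⊗prev-diagonal E d p) (prev-cong (IH d) p)) ⟩
    expansionSum d p M +R x *R ∂e₂ (λ d p → expansionSum d p M) d p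
      +R (x *R x) *R prev (λ p → expansionSum d p M) p
      ≈⟨ quadratic-cong x refl (expansionSum-prev₁ M d p) (expansionSum-prev₂ M d p) ⟨
    expansionSum d p M +R x *R expansionSum d p (λ a b → prev (λ a → M a b) a)
      +R (x *R x) *R expansionSum d p (λ a b → prev (M a) b)
      ≈⟨ antidiagonal-quadratic p x (λ q j → eToM d j · 1R) (λ q j → M (d + 2 * j) q)
           (λ q j → prev (λ a → M a q) (d + 2 * j)) (λ q j → prev (M (d + 2 * j)) q) ⟨
    antidiagonal p (λ q j → (eToM d j · 1R) *R (M (d + 2 * j) q +R x *R prev (λ a → M a q) (d + 2 * j)
                                                   +R (x *R x) *R prev (M (d + 2 * j)) q))
      ≈⟨ antidiagonal-cong p (λ q j _ → *-congˡ (m₂-∷ (d + 2 * j) q x xs)) ⟨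
    expansionSum d p (λ a b → m₂ a b (x ∷ xs)) ∎
    where
    E = eSeq xs
    M = λ a b → m₂ a b xs
    IH = e₂≈expansionSum xs

  m₂≈inversionSum-[] : ∀ d q → m₂ d q [] ≈ inversionSum d q (eSeq [] ⊗ eSeq [])
  m₂≈inversionSum-[] zero    zero    = solve 0 (con 1 := (con 1 :+ con 0) :* (con 1 :* con 1)) refl
  m₂≈inversionSum-[] (suc d) zero    = sym (trans (*-congˡ (zeroˡ _)) (zeroʳ _))
  m₂≈inversionSum-[] d       (suc q) = trans (reflexive (m₂-[]-suc d q)) (sym (begin
    κ (suc q) *R (e (d + 2 * suc q) [] *R 1R)
      +R antidiagonal q (λ r t → κ t *R (e (suc r + (d + 2 * t)) [] *R 0#))
      ≈⟨ +-cong (*-congˡ (*-congʳ (reflexive (≡.cong (λ a → e a []) (+-2*-suc d q)))))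
                (antidiagonal-cong q (λ _ _ _ → trans (*-congˡ (zeroʳ _)) (zeroʳ _))) ⟩
    κ (suc q) *R (0# *R 1R) +R antidiagonal q (λ _ _ → 0#)
      ≈⟨ +-cong (trans (*-congˡ (zeroˡ _)) (zeroʳ _)) (antidiagonal-0# q) ⟩
    0# +R 0#
      ≈⟨ +-identityˡ 0# ⟩
    0# ∎))
    where
    κ : ℕ → S
    κ t = sgn t (mToE d t · 1R)

  m₂≈inversionSum : ∀ xs d q → m₂ d q xs ≈ inversionSum d q (eSeq xs ⊗ eSeq xs)
  m₂≈inversionSum []       d q = m₂≈inversionSum-[] d q
  m₂≈inversionSum (x ∷ xs) d q = begin
    m₂ d q (x ∷ xs)
      ≈⟨ m₂-∷ d q x xs ⟩
    m₂ d q xs +R x *R prev (λ a → m₂ a q xs) d +R (x *R x) *R prev (λ b → m₂ d b xs) q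
      ≈⟨ quadratic-cong x (IH d q) (prev-cong (λ a → IH a q) d) (prev-cong (IH d) q) ⟩
    inversionSum d q E⊗E +R x *R prev (λ d → inversionSum d q E⊗E) d
      +R (x *R x) *R prev (λ q → inversionSum d q E⊗E) q
      ≈⟨ quadratic-cong x refl (inversionSum-∂⊗ E d q) (inversionSum-prev⊗prev E d q) ⟨
    inversionSum d q E⊗E +R x *R inversionSum d q (∂⊗ E)
      +R (x *R x) *R inversionSum d q (prev E ⊗ prev E)
      ≈⟨ antidiagonal-quadratic q x (λ r t → sgn t (mToE d t · 1R)) (λ r t → E⊗E (r + (d + 2 * t)) r)
           (λ r t → ∂⊗ E (r + (d + 2 * t)) r) (λ r t → (prev E ⊗ prev E) (r + (d + 2 * t)) r) ⟨
    antidiagonal q (λ r t → sgn t (mToE d t · 1R) *R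
      (E⊗E (r + (d + 2 * t)) r +R x *R ∂⊗ E (r + (d + 2 * t)) r
        +R (x *R x) *R (prev E ⊗ prev E) (r + (d + 2 * t)) r))
      ≈⟨ antidiagonal-cong q (λ r t _ → *-congˡ (e₂-∷ (r + (d + 2 * t)) r x xs)) ⟨
    inversionSum d q (eSeq (x ∷ xs) ⊗ eSeq (x ∷ xs)) ∎
    where
    E = eSeq xs
    E⊗E = E ⊗ E
    IH = m₂≈inversionSum xs

  expansion-term : ∀ xs d q j {p} → q + j ≡ p →
    (eToM d j · 1R) *R m₂ (d + 2 * j) q xs ≈
      ((2 * p + d ∸ 2 * q) C (p ∸ q)) · m₂ (2 * p + d ∸ 2 * q) q xs
  expansion-term xs d q j ≡.refl = begin
    (eToM d j · 1R) *R m₂ (d + 2 * j) q xs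
      ≈⟨ ·≈·1* (eToM d j) _ ⟨
    eToM d j · m₂ (d + 2 * j) q xs
      ≡⟨ ≡.cong (λ n → n · m₂ (d + 2 * j) q xs) (eToM≡C d j) ⟩
    ((d + 2 * j) C j) · m₂ (d + 2 * j) q xs
      ≡⟨ ≡.cong₂ (λ a j → (a C j) · m₂ a q xs) (≡.sym ones) (≡.sym (ℕ.m+n∸m≡n q j)) ⟩
    ((2 * (q + j) + d ∸ 2 * q) C (q + j ∸ q)) · m₂ (2 * (q + j) + d ∸ 2 * q) q xs ∎
    where
    ones : 2 * (q + j) + d ∸ 2 * q ≡ d + 2 * j
    ones = ≡.trans (≡.cong (_∸ 2 * q) (rearrange q j d)) (ℕ.m+n∸m≡n (2 * q) (d + 2 * j))
      where
      rearrange : ∀ q j d → 2 * (q + j) + d ≡ 2 * q + (d + 2 * j)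
      rearrange = solve-∀

  e₂-expansion : ∀ {n p} → 2 * p ≤ n → ∀ xs →
    e₂ (n ∸ p) p xs ≈ sumTo p (λ q → ((n ∸ 2 * q) C (p ∸ q)) · m (two n q) xs)
  e₂-expansion {p = p} 2p≤n xs with d , ≡.refl ← ℕ.m≤n⇒∃[o]m+o≡n 2p≤n = begin
    e₂ (2 * p + d ∸ p) p xs
      ≡⟨ ≡.cong (λ a → e₂ a p xs)
                (≡.trans (≡.cong (_∸ p) (rearrange p d)) (ℕ.m+n∸m≡n p (p + d))) ⟩
    e₂ (p + d) p xs
      ≈⟨ e₂≈expansionSum xs d p ⟩
    expansionSum d p (λ a b → m₂ a b xs)
      ≈⟨ antidiagonal-sumTo p _ ⟩
    sumTo p (λ q → (eToM d (p ∸ q) · 1R) *R m₂ (d + 2 * (p ∸ q)) q xs)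
      ≈⟨ sumTo-cong p (λ q q≤p → expansion-term xs d q (p ∸ q) (ℕ.m+[n∸m]≡n q≤p)) ⟩
    sumTo p (λ q → ((2 * p + d ∸ 2 * q) C (p ∸ q)) · m₂ (2 * p + d ∸ 2 * q) q xs) ∎
    where
    rearrange : ∀ p d → 2 * p + d ≡ p + (p + d)
    rearrange = solve-∀

  inversion-term : ∀ xs d r t {q n} → r + t ≡ q → suc (2 * q + d) ≡ n →
    sgn t (mToE (suc d) t · 1R) *R e₂ (r + (suc d + 2 * t)) r xs ≈
      sgn q (sgn r (e₂ (n ∸ r) r xs) *R
        ((((n ∸ q) ∸ r) C (n ∸ 2 * q)) · 1R +R ((((n ∸ q) ∸ r) ∸ 1) C (n ∸ 2 * q)) · 1R))
  inversion-term xs d r t ≡.refl ≡.refl = begin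
    sgn t (mToE (suc d) t · 1R) *R X
      ≈⟨ sgn-*ˡ t _ _ ⟩
    sgn t ((mToE (suc d) t · 1R) *R X)
      ≈⟨ sgn-cong t (*-comm _ _) ⟩
    sgn t (X *R mToE (suc d) t · 1R)
      ≈⟨ sgn-cong t (*-cong (reflexive (≡.cong (λ a → e₂ a r xs) e-index)) coefficient) ⟩
    sgn t (e₂ (n ∸ r) r xs *R coeff)
      ≈⟨ sgn-antidiagonal r t ≡.refl _ ⟨
    sgn (r + t) (sgn r (e₂ (n ∸ r) r xs *R coeff))
      ≈⟨ sgn-cong (r + t) (sgn-*ˡ r _ _) ⟨
    sgn (r + t) (sgn r (e₂ (n ∸ r) r xs) *R coeff) ∎
    where
    n = suc (2 * (r + t) + d)
    X = e₂ (r + (suc d + 2 * t)) r xs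
    coeff = (((n ∸ (r + t)) ∸ r) C (n ∸ 2 * (r + t))) · 1R
              +R ((((n ∸ (r + t)) ∸ r) ∸ 1) C (n ∸ 2 * (r + t))) · 1R
    e-index : r + (suc d + 2 * t) ≡ n ∸ r
    e-index = ≡.sym (≡.trans (≡.cong (_∸ r) (rearrange r t d)) (ℕ.m+n∸m≡n r _))
      where
      rearrange : ∀ r t d → suc (2 * (r + t) + d) ≡ r + (r + (suc d + 2 * t))
      rearrange = solve-∀
    ones : n ∸ 2 * (r + t) ≡ suc d
    ones = ≡.trans (≡.cong (_∸ 2 * (r + t)) (≡.sym (ℕ.+-suc (2 * (r + t)) d)))
                   (ℕ.m+n∸m≡n (2 * (r + t)) (suc d))
    parts : (n ∸ (r + t)) ∸ r ≡ suc d + t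
    parts = ≡.trans (ℕ.∸-+-assoc n (r + t) r)
                    (≡.trans (≡.cong (_∸ (r + t + r)) (rearrange r t d))
                             (ℕ.m+n∸m≡n (r + t + r) (suc d + t)))
      where
      rearrange : ∀ r t d → suc (2 * (r + t) + d) ≡ (r + t + r) + (suc d + t)
      rearrange = solve-∀
    coefficient : mToE (suc d) t · 1R ≈ coeff
    coefficient = begin
      mToE (suc d) t · 1R
        ≡⟨ ≡.cong (_· 1R) (mToE≡C d t) ⟩
      ((suc d + t) C suc d + (d + t) C suc d) · 1R
        ≈⟨ ·-homo-+ ((suc d + t) C suc d) ((d + t) C suc d) 1R ⟩
      ((suc d + t) C suc d) · 1R +R ((d + t) C suc d) · 1R
        ≡⟨ ≡.cong₂ (λ N D → (N C D) · 1R +R ((N ∸ 1) C D) · 1R) parts ones ⟨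
      coeff ∎

  m₂-inversion : ∀ {n q} → 2 * q < n → ∀ xs →
    m (two n q) xs ≈ sgn q (sumTo q (λ r → sgn r (e₂ (n ∸ r) r xs) *R
      ((((n ∸ q) ∸ r) C (n ∸ 2 * q)) · 1R +R ((((n ∸ q) ∸ r) ∸ 1) C (n ∸ 2 * q)) · 1R)))
  m₂-inversion {n} {q} 2q<n xs with d , 2q+d≡n ← ℕ.m≤n⇒∃[o]m+o≡n 2q<n = begin
    m₂ (n ∸ 2 * q) q xs
      ≡⟨ ≡.cong (λ a → m₂ a q xs) ones ⟩
    m₂ (suc d) q xs
      ≈⟨ m₂≈inversionSum xs (suc d) q ⟩
    inversionSum (suc d) q (eSeq xs ⊗ eSeq xs)
      ≈⟨ antidiagonal-sumTo q _ ⟩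
    sumTo q (λ r → sgn (q ∸ r) (mToE (suc d) (q ∸ r) · 1R) *R e₂ (r + (suc d + 2 * (q ∸ r))) r xs)
      ≈⟨ sumTo-cong q (λ r r≤q → inversion-term xs d r (q ∸ r) (ℕ.m+[n∸m]≡n r≤q) 2q+d≡n) ⟩
    sumTo q (λ r → sgn q (term r))
      ≈⟨ sumTo-sgn q q term ⟩
    sgn q (sumTo q term) ∎
    where
    ones : n ∸ 2 * q ≡ suc d
    ones = ≡.trans (≡.cong (_∸ 2 * q) (≡.trans (≡.sym 2q+d≡n) (≡.sym (ℕ.+-suc (2 * q) d))))
                   (ℕ.m+n∸m≡n (2 * q) (suc d))
    term : ℕ → S
    term r = sgn r (e₂ (n ∸ r) r xs) *R
      ((((n ∸ q) ∸ r) C (n ∸ 2 * q)) · 1R +R ((((n ∸ q) ∸ r) ∸ 1) C (n ∸ 2 * q)) · 1R)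

  m₂-square-alternating : ∀ {n} h → n ≡ 2 * h → ∀ xs →
    m (two n h) xs ≈ sgn h (sumTo n (λ i → sgn i (e i xs *R e (n ∸ i) xs)))
  m₂-square-alternating h ≡.refl xs = begin
    m₂ (2 * h ∸ 2 * h) h xs
      ≡⟨ ≡.cong (λ a → m₂ a h xs) (ℕ.n∸n≡0 (2 * h)) ⟩
    m₂ 0 h xs
      ≈⟨ m₂≈inversionSum xs 0 h ⟩
    inversionSum 0 h (eSeq xs ⊗ eSeq xs)
      ≈⟨ inversionSum-alternating (eSeq xs ⊗ eSeq xs) (λ i j → *-comm _ _) h ⟩
    sgn h (antidiagonal (2 * h) (λ i j → sgn i (e i xs *R e j xs)))
      ≈⟨ sgn-cong h (antidiagonal-sumTo (2 * h) _) ⟩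
    sgn h (sumTo (2 * h) (λ i → sgn i (e i xs *R e (2 * h ∸ i) xs))) ∎

  square-term : ∀ xs r t {h} → r + t ≡ h →
    sgn (suc t) (2 · 1R) *R e₂ (r + 2 * suc t) r xs ≈
      (2 · 1R) *R sgn (suc h) (sgn r (e₂ (2 * suc h ∸ r) r xs))
  square-term xs r t ≡.refl = begin
    sgn (suc t) (2 · 1R) *R X
      ≈⟨ sgn-*ˡ (suc t) _ _ ⟩
    sgn (suc t) ((2 · 1R) *R X)
      ≈⟨ sgn-antidiagonal r (suc t) (ℕ.+-suc r t) _ ⟨
    sgn (suc (r + t)) (sgn r ((2 · 1R) *R X))
      ≈⟨ sgn-cong (suc (r + t)) (sgn-*ʳ r _ _) ⟨
    sgn (suc (r + t)) ((2 · 1R) *R sgn r X)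
      ≈⟨ sgn-*ʳ (suc (r + t)) _ _ ⟨
    (2 · 1R) *R sgn (suc (r + t)) (sgn r X)
      ≡⟨ ≡.cong (λ a → (2 · 1R) *R sgn (suc (r + t)) (sgn r (e₂ a r xs))) e-index ⟩
    (2 · 1R) *R sgn (suc (r + t)) (sgn r (e₂ (2 * suc (r + t) ∸ r) r xs)) ∎
    where
    X = e₂ (r + 2 * suc t) r xs
    e-index : r + 2 * suc t ≡ 2 * suc (r + t) ∸ r
    e-index = ≡.sym (≡.trans (≡.cong (_∸ r) (rearrange r t)) (ℕ.m+n∸m≡n r _))
      where
      rearrange : ∀ r t → 2 * suc (r + t) ≡ r + (r + 2 * suc t)
      rearrange = solve-∀

  m₂-square : ∀ {n} h → n ≡ 2 * suc h → ∀ xs → m (two n (suc h)) xs ≈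
    e₂ (suc h) (suc h) xs +R 2 · sgn (suc h) (sumTo h (λ r → sgn r (e₂ (n ∸ r) r xs)))
  m₂-square h ≡.refl xs = begin
    m₂ (2 * suc h ∸ 2 * suc h) (suc h) xs
      ≡⟨ ≡.cong (λ a → m₂ a (suc h) xs) (ℕ.n∸n≡0 (2 * suc h)) ⟩
    m₂ 0 (suc h) xs
      ≈⟨ m₂≈inversionSum xs 0 (suc h) ⟩
    inversionSum 0 (suc h) (eSeq xs ⊗ eSeq xs)
      ≈⟨ antidiagonal-last h (λ r t → sgn t (mToE 0 t · 1R) *R e₂ (r + 2 * t) r xs) ⟩
    antidiagonal h (λ r t → sgn (suc t) (2 · 1R) *R e₂ (r + 2 * suc t) r xs)
      +R (1R +R 0#) *R e₂ (suc h + 0) (suc h) xs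
      ≈⟨ +-comm _ _ ⟩
    (1R +R 0#) *R e₂ (suc h + 0) (suc h) xs
      +R antidiagonal h (λ r t → sgn (suc t) (2 · 1R) *R e₂ (r + 2 * suc t) r xs)
      ≈⟨ +-cong diagonal (antidiagonal-cong h (λ r t → square-term xs r t)) ⟩
    e₂ (suc h) (suc h) xs +R antidiagonal h (λ r t → (2 · 1R) *R sgn (suc h) (sgn r (Y r)))
      ≈⟨ +-congˡ (antidiagonal-*ˡ h _ _) ⟩
    e₂ (suc h) (suc h) xs +R (2 · 1R) *R antidiagonal h (λ r t → sgn (suc h) (sgn r (Y r)))
      ≈⟨ +-congˡ (*-congˡ (antidiagonal-sgn h (suc h) _)) ⟩
    e₂ (suc h) (suc h) xs +R (2 · 1R) *R sgn (suc h) (antidiagonal h (λ r t → sgn r (Y r)))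
      ≈⟨ +-congˡ (*-congˡ (sgn-cong (suc h) (antidiagonal-sumTo h _))) ⟩
    e₂ (suc h) (suc h) xs +R (2 · 1R) *R sgn (suc h) (sumTo h (λ r → sgn r (Y r)))
      ≈⟨ +-congˡ (·≈·1* 2 _) ⟨
    e₂ (suc h) (suc h) xs +R 2 · sgn (suc h) (sumTo h (λ r → sgn r (Y r))) ∎
    where
    Y : ℕ → S
    Y r = e₂ (2 * suc h ∸ r) r xs
    diagonal : (1R +R 0#) *R e₂ (suc h + 0) (suc h) xs ≈ e₂ (suc h) (suc h) xs
    diagonal = trans (*-congʳ (+-identityʳ 1R))
                     (trans (*-identityˡ _)
                            (reflexive (≡.cong (λ a → e₂ a (suc h) xs) (ℕ.+-identityʳ (suc h)))))

corollary5p3 : ∀ {c ℓ} (R : CommutativeRing c ℓ) (k : ℕ) → 0 < k → 2 ∣ k →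
  let open Sym R
  in (∀ (p : ℕ) → p ≤ k / 2 → ∀ (xs : List S) →
        e₂ (k ∸ p) p xs ≈R sumTo p (λ q → ((k ∸ 2 * q) C (p ∸ q)) · m (two k q) xs))
     × (∀ (q : ℕ) → q ≤ k / 2 ∸ 1 → ∀ (xs : List S) →
        m (two k q) xs ≈R sgn q (sumTo q (λ r → sgn r (e₂ (k ∸ r) r xs)
          *R ((((k ∸ q) ∸ r) C (k ∸ 2 * q)) · 1R
             +R ((((k ∸ q) ∸ r) ∸ 1) C (k ∸ 2 * q)) · 1R))))
     × (∀ (xs : List S) →
        (m (two k (k / 2)) xs ≈R e₂ (k / 2) (k / 2) xs
          +R 2 · sgn (k / 2) (sumTo (k / 2 ∸ 1) (λ r → sgn r (e₂ (k ∸ r) r xs))))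
        × (e₂ (k / 2) (k / 2) xs
          +R 2 · sgn (k / 2) (sumTo (k / 2 ∸ 1) (λ r → sgn r (e₂ (k ∸ r) r xs)))
          ≈R sgn (k / 2) (sumTo k (λ i → sgn i (e i xs *R e (k ∸ i) xs)))))
corollary5p3 R .(zero * 2)  ()  (divides zero ≡.refl)
corollary5p3 R .(suc h * 2) _   (divides (suc h) ≡.refl)
  rewrite m*n/n≡m (suc h) 2 ⦃ _ ⦄ =
    (λ p p≤h xs → e₂-expansion {p = p} (ℕ.≤-trans (ℕ.*-monoʳ-≤ 2 p≤h) 2[1+h]≤k) xs) ,
    (λ q q≤h xs → m₂-inversion {q = q} (ℕ.<-≤-trans (ℕ.*-monoʳ-< 2 (s≤s q≤h)) 2[1+h]≤k) xs) ,
    λ xs → m₂-square h k≡2[1+h] xs ,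
           trans (sym (m₂-square h k≡2[1+h] xs)) (m₂-square-alternating (suc h) k≡2[1+h] xs)
  where
  open TwoRow R
  open CommutativeRing R using (sym; trans)
  k≡2[1+h] : suc h * 2 ≡ 2 * suc h
  k≡2[1+h] = ℕ.*-comm (suc h) 2
  2[1+h]≤k : 2 * suc h ≤ suc h * 2
  2[1+h]≤k = ℕ.≤-reflexive (≡.sym k≡2[1+h])
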